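{- Let $G=(A,B,E)$ and $H=(C,D,F)$ be balanced bipartite graphs that are both $\alpha$-stable. Then their Kronecker product $G\otimes H$ is $\alpha$-stable.
   Context: All graphs are finite and simple. A bipartite graph $(A,B,E)$ is balanced if $|A|=|B|$. The Kronecker product $G\otimes H=(A\times C,B\times D,U)$ is the bipartite graph with classes $A\times C$ and $B\times D$ in which $(a,c)(b,d)\in U$ if and only if $ab\in E$ and $cd\in F$. $\alpha(G)$ is the largest size of a stable set. A graph is $\alpha^-$-stable if $\alpha(G-e)=\alpha(G)$ for every edge $e$; $\alpha^+$-stable if $\alpha(G+e)=\alpha(G)$ for every pair $e=xy$ of distinct nonadjacent vertices; $\alpha$-stable if both. -}

module Defs where

open import Data.Nat using (ℕ; _≤_)
open import Data.Fin using (Fin)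
open import Data.Bool using (Bool; T; _∧_)
open import Data.Empty using (⊥)
open import Data.Product using (_×_; _,_; Σ)
open import Data.Sum using (_⊎_; inj₁; inj₂)
open import Data.List using (List; length)
open import Data.List.Membership.Propositional using (_∈_)
open import Data.List.Relation.Unary.Unique.Propositional using (Unique)
open import Relation.Nullary using (¬_)
open import Relation.Binary.PropositionalEquality using (_≡_; _≢_)

-- General (simple) graphs on a vertex type V, given by an adjacency
-- relation.  Stable sets are duplicate-free lists of vertices; their
-- size is the length of the list.

Adj : Set → Set₁
Adj V = V → V → Set

SamePair : {V : Set} → V → V → V → V → Set
SamePair u v x y = (x ≡ u × y ≡ v) ⊎ (x ≡ v × y ≡ u)

deleteEdge : {V : Set} → Adj V → V → V → Adj V
deleteEdge adj u v x y = adj x y × ¬ SamePair u v x y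

addEdge : {V : Set} → Adj V → V → V → Adj V
addEdge adj u v x y = adj x y ⊎ SamePair u v x y

IsStable : {V : Set} → Adj V → List V → Set
IsStable adj S = Unique S × (∀ x y → x ∈ S → y ∈ S → ¬ adj x y)

IsAlpha : {V : Set} → Adj V → ℕ → Set
IsAlpha adj k =
  Σ (List _) (λ S → IsStable adj S × length S ≡ k)
  × (∀ S → IsStable adj S → length S ≤ k)

AlphaMinusStable : {V : Set} → Adj V → Set
AlphaMinusStable adj =
  ∀ u v → adj u v → ∀ k → IsAlpha adj k → IsAlpha (deleteEdge adj u v) k

AlphaPlusStable : {V : Set} → Adj V → Set
AlphaPlusStable adj =
  ∀ u v → u ≢ v → ¬ adj u v → ∀ k → IsAlpha adj k → IsAlpha (addEdge adj u v) k

AlphaStable : {V : Set} → Adj V → Set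
AlphaStable adj = AlphaMinusStable adj × AlphaPlusStable adj

record Bipartite (X Y : Set) : Set where
  constructor bip
  field
    E : X → Y → Bool

open Bipartite public

Balanced : ℕ → Set
Balanced n = Bipartite (Fin n) (Fin n)

adjB : {X Y : Set} → Bipartite X Y → Adj (X ⊎ Y)
adjB G (inj₁ a) (inj₁ a') = ⊥
adjB G (inj₁ a) (inj₂ b)  = T (E G a b)
adjB G (inj₂ b) (inj₁ a)  = T (E G a b)
adjB G (inj₂ b) (inj₂ b') = ⊥

_⊗_ : {X Y Z W : Set} → Bipartite X Y → Bipartite Z W → Bipartite (X × Z) (Y × W)
G ⊗ H = bip (λ { (a , c) (b , d) → E G a b ∧ E H c d })

-- An α⁺-stable balanced bipartite graph G with sides A, B of size n has α(G) = n.  Write stable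
-- sets as pairs (P ⊆ A, Q ⊆ B) with no edge between P and Q.  As |·| is modular, two maximum pairs
-- (P₁, Q₁), (P, Q) give stable pairs (P₁ ∩ P, Q₁ ∪ Q), (P₁ ∪ P, Q₁ ∩ Q) whose sizes add up to 2α,
-- so both are maximum.  If α(G) > n, a maximum pair whose Q-side is largest has P₁ ≠ ∅, and every
-- u ∈ P₁ lies in every maximum pair; symmetrically some v ∈ B does.  Then u, v are nonadjacent and
-- every maximum stable set of G + uv would contain both, contradicting α(G + uv) = α(G).
--
-- For a stable set S of G ⊗ H put x c = |S ∩ (A × {c})| and y d = |S ∩ (B × {d})|.  Along every
-- edge cd of H the two slices form a stable pair of G, so x c + y d ≤ n.  Cutting the weights into
-- the levels {c | t < x c} and {d | n ∸ y d ≤ t} (t < n), each a stable pair of H, gives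
-- |S| ≤ n · α(H) = n m, attained by A × C and by B × D.  Deleting an edge of G ⊗ H deletes an edge
-- in a single slice, where α⁻-stability of G keeps the bound n; adding an edge leaves A × C or
-- B × D stable.

module Submission where

open import Defs

open import Algebra.Properties.CommutativeSemigroup using (interchange)
open import Data.Bool using (Bool; true; false; T; _∧_)
open import Data.Bool.Properties using (T-∧)
open import Data.Empty using (⊥; ⊥-elim)
open import Data.Fin using (Fin; zero; suc; toℕ)
import Data.Fin.Properties as Fin
open import Data.Fin.Subset using (Subset; inside; outside; ⊤; _∩_; _∪_; _⊂_; ∣_∣)
  renaming (_∈_ to _∈ₛ_; ⊥ to ∅)
open import Data.Fin.Subset.Properties
  using ( ∣p∣≤n; ∣⊤∣≡n; ∣⊥∣≡0; ∉⊥; x∈p∪q⁻; x∈p∩q⁻; p∩q⊆p; p⊂q⇒∣p∣<∣q∣; nonempty?; Empty-unique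
        ; anySubset? ) renaming (_∈?_ to _∈ₛ?_)
open import Data.List using (List; []; _∷_; length; map; _++_; cartesianProduct; allFin)
open import Data.List.Membership.Propositional using (_∈_; _∉_)
open import Data.List.Membership.Propositional.Properties using (∈-map⁻; ∈-++⁻)
open import Data.List.Properties using (length-map; length-++; length-tabulate)
open import Data.List.Relation.Binary.Disjoint.Propositional using (Disjoint)
open import Data.List.Relation.Unary.All.Properties using (¬Any⇒All¬)
open import Data.List.Relation.Unary.AllPairs using ([]; _∷_)
open import Data.List.Relation.Unary.Any using (here; there)
open import Data.List.Relation.Unary.Unique.Propositional using (Unique)
open import Data.List.Relation.Unary.Unique.Propositional.Properties
  using (map⁺; ++⁺; cartesianProduct⁺; allFin⁺; Unique[x∷xs]⇒x∉xs)
open import Data.Nat using (ℕ; zero; suc; _+_; _*_; _∸_; _≤_; _<_; _<?_; z≤n; s≤s)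
open import Data.Nat.Properties
  using ( ≤-refl; ≤-reflexive; ≤-trans; ≤-antisym; <-irrefl; ≤-<-trans; <-≤-trans; <⇒≱; ≮⇒≥; _≤?_
        ; module ≤-Reasoning; +-comm; +-suc; +-identityʳ; +-mono-≤; +-monoʳ-≤; +-monoˡ-<; +-mono-<-≤
        ; +-cancelʳ-≤; m≤m+n; m≤n+m; 0∸n≡0; m∸n+n≡m; m∸[m∸n]≡n
        ; +-commutativeSemigroup; +-0-commutativeMonoid )
open import Data.Product using (_×_; _,_; proj₁; proj₂; ∃)
import Data.Product.Properties as Prod
open import Data.Sum using (_⊎_; inj₁; inj₂; swap)
import Data.Sum.Properties as Sum
open import Data.Vec using (_∷_; []; tabulate)
import Data.Vec as Vec
open import Data.Vec.Properties using (lookup∘tabulate; []=⇒lookup)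
open import Function using (_∘_; flip; id)
open import Function.Bundles using (Equivalence)
open import Function.Definitions using (Injective)
open import Relation.Binary.Core using (_⇒_)
open import Relation.Binary.Definitions using (DecidableEquality)
open import Relation.Binary.PropositionalEquality
open import Relation.Binary.Structures using (IsDecEquivalence)
open import Relation.Binary.TypeClasses using (_≟_)
open import Relation.Nullary using (¬_; Dec; yes; no; does; ¬?; _×-dec_)
import Relation.Nullary.Decidable as Dec
open import Relation.Nullary.Decidable using (_→-dec_; T?; dec-true; dec-false)

open import Algebra.Properties.CommutativeMonoid.Sum +-0-commutativeMonoid
  using (sum; sum-syntax; sum-cong-≗; ∑-distrib-+; ∑-comm)

open Equivalence using (from; to)

does⇒ : ∀ {A : Set} (a? : Dec A) → T (does a?) → A
does⇒ (yes a) _ = a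

⇒does : ∀ {A : Set} (a? : Dec A) → A → T (does a?)
⇒does a? a = subst T (sym (dec-true a? a)) _

𝟙 : Bool → ℕ
𝟙 true  = 1
𝟙 false = 0

∑-mono-≤ : ∀ {n} {f g : Fin n → ℕ} → (∀ i → f i ≤ g i) → ∑[ i < n ] f i ≤ ∑[ i < n ] g i
∑-mono-≤ {zero}  f≤g = z≤n
∑-mono-≤ {suc n} f≤g = +-mono-≤ (f≤g zero) (∑-mono-≤ (f≤g ∘ suc))

∑-const : ∀ n k → ∑[ i < n ] k ≡ n * k
∑-const zero    k = refl
∑-const (suc n) k = cong (k +_) (∑-const n k)

∑-< : ∀ N {k} → k ≤ N → ∑[ t < N ] 𝟙 (does (toℕ t <? k)) ≡ k
∑-< zero    z≤n       = refl
∑-< (suc N) {zero}  _ = ∑-< N {0} z≤n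
∑-< (suc N) {suc k} (s≤s k≤N) = cong suc (∑-< N {k} k≤N)

∑-≮ : ∀ N k → ∑[ t < N ] 𝟙 (does (¬? (toℕ t <? k))) ≡ N ∸ k
∑-≮ zero    k       = sym (0∸n≡0 k)
∑-≮ (suc N) zero    = cong suc (∑-≮ N zero)
∑-≮ (suc N) (suc k) = ∑-≮ N k

∣tabulate∣ : ∀ {n} (f : Fin n → Bool) → ∣ tabulate f ∣ ≡ ∑[ i < n ] 𝟙 (f i)
∣tabulate∣ {zero}  f = refl
∣tabulate∣ {suc n} f with f zero
... | true  = cong suc (∣tabulate∣ (f ∘ suc))
... | false = ∣tabulate∣ (f ∘ suc)

∈-tabulate⁻ : ∀ {n} {f : Fin n → Bool} {i} → i ∈ₛ tabulate f → T (f i)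
∈-tabulate⁻ {f = f} {i} i∈ = subst T (sym (trans (sym (lookup∘tabulate f i)) ([]=⇒lookup i∈))) _

∣p∩q∣+∣p∪q∣≡∣p∣+∣q∣ : ∀ {n} (p q : Subset n) → ∣ p ∩ q ∣ + ∣ p ∪ q ∣ ≡ ∣ p ∣ + ∣ q ∣
∣p∩q∣+∣p∪q∣≡∣p∣+∣q∣ [] [] = refl
∣p∩q∣+∣p∪q∣≡∣p∣+∣q∣ (inside ∷ p) (inside ∷ q) =
  cong suc (trans (+-suc _ _) (trans (cong suc (∣p∩q∣+∣p∪q∣≡∣p∣+∣q∣ p q)) (sym (+-suc _ _))))
∣p∩q∣+∣p∪q∣≡∣p∣+∣q∣ (inside ∷ p) (outside ∷ q) =
  trans (+-suc _ _) (cong suc (∣p∩q∣+∣p∪q∣≡∣p∣+∣q∣ p q))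
∣p∩q∣+∣p∪q∣≡∣p∣+∣q∣ (outside ∷ p) (inside ∷ q) =
  trans (+-suc _ _) (trans (cong suc (∣p∩q∣+∣p∪q∣≡∣p∣+∣q∣ p q)) (sym (+-suc _ _)))
∣p∩q∣+∣p∪q∣≡∣p∣+∣q∣ (outside ∷ p) (outside ∷ q) = ∣p∩q∣+∣p∪q∣≡∣p∣+∣q∣ p q

∩∪-∪∩-size : ∀ {p q} (P₁ P : Subset p) (Q₁ Q : Subset q) →
             (∣ P₁ ∩ P ∣ + ∣ Q₁ ∪ Q ∣) + (∣ P₁ ∪ P ∣ + ∣ Q₁ ∩ Q ∣) ≡ (∣ P₁ ∣ + ∣ Q₁ ∣) + (∣ P ∣ + ∣ Q ∣)
∩∪-∪∩-size P₁ P Q₁ Q = begin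
  (∣ P₁ ∩ P ∣ + ∣ Q₁ ∪ Q ∣) + (∣ P₁ ∪ P ∣ + ∣ Q₁ ∩ Q ∣)
    ≡⟨ interchange +-commutativeSemigroup (∣ P₁ ∩ P ∣) (∣ Q₁ ∪ Q ∣) (∣ P₁ ∪ P ∣) (∣ Q₁ ∩ Q ∣) ⟩
  (∣ P₁ ∩ P ∣ + ∣ P₁ ∪ P ∣) + (∣ Q₁ ∪ Q ∣ + ∣ Q₁ ∩ Q ∣)
    ≡⟨ cong₂ _+_ (∣p∩q∣+∣p∪q∣≡∣p∣+∣q∣ P₁ P)
                 (trans (+-comm (∣ Q₁ ∪ Q ∣) (∣ Q₁ ∩ Q ∣)) (∣p∩q∣+∣p∪q∣≡∣p∣+∣q∣ Q₁ Q)) ⟩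
  (∣ P₁ ∣ + ∣ P ∣) + (∣ Q₁ ∣ + ∣ Q ∣)
    ≡⟨ interchange +-commutativeSemigroup (∣ P₁ ∣) (∣ P ∣) (∣ Q₁ ∣) (∣ Q ∣) ⟩
  (∣ P₁ ∣ + ∣ Q₁ ∣) + (∣ P ∣ + ∣ Q ∣)
    ∎
  where open ≡-Reasoning

elements : ∀ {n} → Subset n → List (Fin n)
elements []            = []
elements (inside ∷ p)  = zero ∷ map suc (elements p)
elements (outside ∷ p) = map suc (elements p)

length-elements : ∀ {n} (p : Subset n) → length (elements p) ≡ ∣ p ∣
length-elements []            = refl
length-elements (inside ∷ p)  = cong suc (trans (length-map suc (elements p)) (length-elements p))
length-elements (outside ∷ p) = trans (length-map suc (elements p)) (length-elements p)

∈-elements⁻ : ∀ {n} (p : Subset n) {i} → i ∈ elements p → i ∈ₛ p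
∈-elements⁻ (inside ∷ p) (here refl) = Vec.here
∈-elements⁻ (inside ∷ p) (there i∈) with ∈-map⁻ suc i∈
... | j , j∈ , refl = Vec.there (∈-elements⁻ p j∈)
∈-elements⁻ (outside ∷ p) i∈ with ∈-map⁻ suc i∈
... | j , j∈ , refl = Vec.there (∈-elements⁻ p j∈)

elements-unique : ∀ {n} (p : Subset n) → Unique (elements p)
elements-unique []            = []
elements-unique (inside ∷ p)  = ¬Any⇒All¬ _ zero∉ ∷ map⁺ Fin.suc-injective (elements-unique p)
  where
  zero∉ : zero ∉ map suc (elements p)
  zero∉ z∈ with ∈-map⁻ suc z∈
  ... | _ , _ , ()
elements-unique (outside ∷ p) = map⁺ Fin.suc-injective (elements-unique p)

record Summation (V : Set) : Set where
  field
    ∑      : (V → ℕ) → ℕ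
    ∑-cong : ∀ {f g} → (∀ v → f v ≡ g v) → ∑ f ≡ ∑ g
    ∑-+    : ∀ f g → ∑ (λ v → f v + g v) ≡ ∑ f + ∑ g
    ≤-∑    : ∀ f v → f v ≤ ∑ f

open Summation

Fin-summation : ∀ n → Summation (Fin n)
Fin-summation n = record { ∑ = sum ; ∑-cong = sum-cong-≗ ; ∑-+ = ∑-distrib-+ ; ≤-∑ = term≤sum }
  where
  term≤sum : ∀ {n} (f : Fin n → ℕ) i → f i ≤ sum f
  term≤sum f zero    = m≤m+n _ _
  term≤sum f (suc i) = ≤-trans (term≤sum (f ∘ suc) i) (m≤n+m _ _)

_⊎-summation_ : ∀ {X Y} → Summation X → Summation Y → Summation (X ⊎ Y)
SX ⊎-summation SY = record
  { ∑      = λ f → ∑ SX (f ∘ inj₁) + ∑ SY (f ∘ inj₂)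
  ; ∑-cong = λ f≗g → cong₂ _+_ (∑-cong SX (f≗g ∘ inj₁)) (∑-cong SY (f≗g ∘ inj₂))
  ; ∑-+    = λ f g → trans (cong₂ _+_ (∑-+ SX (f ∘ inj₁) (g ∘ inj₁)) (∑-+ SY (f ∘ inj₂) (g ∘ inj₂)))
                           (interchange +-commutativeSemigroup
                              (∑ SX (f ∘ inj₁)) (∑ SX (g ∘ inj₁)) (∑ SY (f ∘ inj₂)) (∑ SY (g ∘ inj₂)))
  ; ≤-∑    = λ { f (inj₁ x) → ≤-trans (≤-∑ SX (f ∘ inj₁) x) (m≤m+n _ _)
               ; f (inj₂ y) → ≤-trans (≤-∑ SY (f ∘ inj₂) y) (m≤n+m _ _) }
  }

_×-summation_ : ∀ {X Y} → Summation X → Summation Y → Summation (X × Y)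
SX ×-summation SY = record
  { ∑      = λ f → ∑ SX (λ x → ∑ SY (λ y → f (x , y)))
  ; ∑-cong = λ f≗g → ∑-cong SX (λ x → ∑-cong SY (λ y → f≗g (x , y)))
  ; ∑-+    = λ f g → trans (∑-cong SX (λ x → ∑-+ SY _ _)) (∑-+ SX _ _)
  ; ≤-∑    = λ f (x , y) → ≤-trans (≤-∑ SY (λ y → f (x , y)) y) (≤-∑ SX _ x)
  }

module Traces {V : Set} (_≟_ : DecidableEquality V) where
  open import Data.List.Membership.DecPropositional _≟_ public using (_∈?_)

  𝟙[∈∷] : ∀ {x S} → x ∉ S → ∀ v → 𝟙 (does (v ∈? x ∷ S)) ≡ 𝟙 (does (v ≟ x)) + 𝟙 (does (v ∈? S))
  𝟙[∈∷] {x} {S} x∉S v with v ≟ x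
  ... | yes refl = cong suc (cong 𝟙 (sym (dec-false (v ∈? S) x∉S)))
  ... | no _     = refl

  length≤∑𝟙[∈] : (Σᵥ : Summation V) → ∀ {S} → Unique S → length S ≤ ∑ Σᵥ (λ v → 𝟙 (does (v ∈? S)))
  length≤∑𝟙[∈] Σᵥ {[]}    _ = z≤n
  length≤∑𝟙[∈] Σᵥ {x ∷ S} S! = begin
    1 + length S                                       ≤⟨ +-mono-≤ x-counted (length≤∑𝟙[∈] Σᵥ (tail S!)) ⟩
    ∑ Σᵥ (λ v → 𝟙 (does (v ≟ x))) + ∑ Σᵥ (λ v → 𝟙 (does (v ∈? S))) ≡⟨ ∑-+ Σᵥ _ _ ⟨
    ∑ Σᵥ (λ v → 𝟙 (does (v ≟ x)) + 𝟙 (does (v ∈? S)))  ≡⟨ ∑-cong Σᵥ (𝟙[∈∷] (Unique[x∷xs]⇒x∉xs S!)) ⟨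
    ∑ Σᵥ (λ v → 𝟙 (does (v ∈? x ∷ S)))                 ∎
    where
    open ≤-Reasoning
    tail : ∀ {y ys} → Unique (y ∷ ys) → Unique ys
    tail (_ ∷ ys!) = ys!
    x-counted : 1 ≤ ∑ Σᵥ (λ v → 𝟙 (does (v ≟ x)))
    x-counted = subst (_≤ ∑ Σᵥ (λ v → 𝟙 (does (v ≟ x)))) (cong 𝟙 (dec-true (x ≟ x) refl))
                      (≤-∑ Σᵥ (λ v → 𝟙 (does (v ≟ x))) x)

  trace : ∀ {n} → (Fin n → V) → List V → Subset n
  trace ι S = tabulate (λ i → does (ι i ∈? S))

  ∈-trace⁻ : ∀ {n} {ι : Fin n → V} {S i} → i ∈ₛ trace ι S → ι i ∈ S
  ∈-trace⁻ {ι = ι} {S} {i} i∈ = does⇒ (ι i ∈? S) (∈-tabulate⁻ i∈)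

  ∣trace∣ : ∀ {n} (ι : Fin n → V) S → ∣ trace ι S ∣ ≡ ∑[ i < n ] 𝟙 (does (ι i ∈? S))
  ∣trace∣ ι S = ∣tabulate∣ (λ i → does (ι i ∈? S))

Searchable : Set → Set₁
Searchable A = ∀ {D : A → Set} → (∀ x → Dec (D x)) → Dec (∃ D)

argmax : ∀ {A} → Searchable A → {D : A → Set} → (∀ x → Dec (D x)) → (w : A → ℕ) →
         ∀ {B} → (∀ x → D x → w x ≤ B) → ∃ D → ∃ λ x → D x × ∀ y → D y → w y ≤ w x
argmax search {D} D? w {B} bounded (x₀ , D₀) = climb B x₀ D₀ (m≤m+n B (w x₀))
  where
  climb : ∀ fuel x → D x → B ≤ fuel + w x → ∃ λ x → D x × ∀ y → D y → w y ≤ w x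
  climb fuel x Dx B≤ with search (λ y → D? y ×-dec (suc (w x) ≤? w y))
  ... | no nothing-better = x , Dx , λ y Dy → ≮⇒≥ (λ x<y → nothing-better (y , Dy , x<y))
  climb zero       x Dx B≤ | yes (y , Dy , x<y) = ⊥-elim (<⇒≱ x<y (≤-trans (bounded y Dy) B≤))
  climb (suc fuel) x Dx B≤ | yes (y , Dy , x<y) =
    climb fuel y Dy (≤-trans B≤ (subst (_≤ fuel + w y) (+-suc fuel (w x)) (+-monoʳ-≤ fuel x<y)))

IsStable-antitone : ∀ {V} {adj adj′ : Adj V} → adj ⇒ adj′ → ∀ {S} → IsStable adj′ S → IsStable adj S
IsStable-antitone adj⇒adj′ (S! , no-edge) = S! , λ x y x∈ y∈ → no-edge x y x∈ y∈ ∘ adj⇒adj′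

IsAlpha-deleteEdge : ∀ {V} {adj : Adj V} {u v k} → IsAlpha adj k →
                     (∀ S → IsStable (deleteEdge adj u v) S → length S ≤ k) →
                     IsAlpha (deleteEdge adj u v) k
IsAlpha-deleteEdge ((S , stable , refl) , _) bound = (S , IsStable-antitone proj₁ stable , refl) , bound

IsAlpha-addEdge : ∀ {V} {adj : Adj V} {u v k} → IsAlpha adj k →
                  (∃ λ S → IsStable (addEdge adj u v) S × length S ≡ k) →
                  IsAlpha (addEdge adj u v) k
IsAlpha-addEdge (_ , bound) witness = witness , λ S stable → bound S (IsStable-antitone inj₁ stable)

deleteEdge-sym : ∀ {V} {adj : Adj V} {u v} → deleteEdge adj u v ⇒ deleteEdge adj v u
deleteEdge-sym (e , not-uv) = e , not-uv ∘ swap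

map-stable : ∀ {X V : Set} {adj : Adj V} {ι : X → V} → Injective _≡_ _≡_ ι →
             (∀ x y → ¬ adj (ι x) (ι y)) → ∀ {xs} → Unique xs → IsStable adj (map ι xs)
map-stable {adj = adj} {ι} ι-injective no-edge {xs} xs! = map⁺ ι-injective xs! , no-edge′
  where
  no-edge′ : ∀ x y → x ∈ map ι xs → y ∈ map ι xs → ¬ adj x y
  no-edge′ x y x∈ y∈ with ∈-map⁻ ι x∈ | ∈-map⁻ ι y∈
  ... | x′ , _ , refl | y′ , _ , refl = no-edge x′ y′

-- Stable sets of bipartite graphs as pairs of subsets

_ᵀ : ∀ {X Y} → Bipartite X Y → Bipartite Y X
G ᵀ = bip (flip (E G))

Independent : ∀ {p q} → Bipartite (Fin p) (Fin q) → Subset p → Subset q → Set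
Independent G P Q = ∀ a b → a ∈ₛ P → b ∈ₛ Q → ¬ T (E G a b)

independent? : ∀ {p q} (G : Bipartite (Fin p) (Fin q)) P Q → Dec (Independent G P Q)
independent? G P Q = Fin.all? λ a → Fin.all? λ b → a ∈ₛ? P →-dec (b ∈ₛ? Q →-dec ¬? (T? (E G a b)))

Independent-ᵀ : ∀ {p q} {G : Bipartite (Fin p) (Fin q)} {P Q} → Independent G P Q → Independent (G ᵀ) Q P
Independent-ᵀ ind b a b∈ a∈ = ind a b a∈ b∈

IndependenceBound : ∀ {p q} → Bipartite (Fin p) (Fin q) → ℕ → Set
IndependenceBound G k = ∀ P Q → Independent G P Q → ∣ P ∣ + ∣ Q ∣ ≤ k

Maximum : ∀ {p q} → Bipartite (Fin p) (Fin q) → ℕ → Subset p × Subset q → Set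
Maximum G k (P , Q) = Independent G P Q × k ≤ ∣ P ∣ + ∣ Q ∣

IsIndependenceNumber : ∀ {p q} → Bipartite (Fin p) (Fin q) → ℕ → Set
IsIndependenceNumber G k = ∃ (Maximum G k) × IndependenceBound G k

searchable-Subset² : ∀ {p q} → Searchable (Subset p × Subset q)
searchable-Subset² D? = Dec.map′ (λ (P , Q , d) → (P , Q) , d) (λ ((P , Q) , d) → P , Q , d)
                          (anySubset? λ P → anySubset? λ Q → D? (P , Q))

independence-number : ∀ {p q} (G : Bipartite (Fin p) (Fin q)) → ∃ (IsIndependenceNumber G)
independence-number {p} {q} G with argmax searchable-Subset² (λ (P , Q) → independent? G P Q)
                                      (λ (P , Q) → ∣ P ∣ + ∣ Q ∣) {p + q}
                                      (λ (P , Q) _ → +-mono-≤ (∣p∣≤n P) (∣p∣≤n Q))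
                                      ((∅ , ∅) , λ _ _ a∈∅ → ⊥-elim (∉⊥ a∈∅))
... | (P , Q) , ind , largest = ∣ P ∣ + ∣ Q ∣ , ((P , Q) , ind , ≤-refl) , λ P′ Q′ → largest (P′ , Q′)

IndependenceBound⇒∣P∣≤ : ∀ {p q} {G : Bipartite (Fin p) (Fin q)} {k} → IndependenceBound G k → ∀ P → ∣ P ∣ ≤ k
IndependenceBound⇒∣P∣≤ bound P = ≤-trans (m≤m+n _ _) (bound P ∅ λ _ _ _ b∈∅ → ⊥-elim (∉⊥ b∈∅))

IndependenceBound⇒∣Q∣≤ : ∀ {p q} {G : Bipartite (Fin p) (Fin q)} {k} → IndependenceBound G k → ∀ Q → ∣ Q ∣ ≤ k
IndependenceBound⇒∣Q∣≤ bound Q = ≤-trans (m≤n+m _ _) (bound ∅ Q λ _ _ a∈∅ → ⊥-elim (∉⊥ a∈∅))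

vertices : ∀ {p q} → Subset p → Subset q → List (Fin p ⊎ Fin q)
vertices P Q = map inj₁ (elements P) ++ map inj₂ (elements Q)

length-vertices : ∀ {p q} (P : Subset p) (Q : Subset q) → length (vertices P Q) ≡ ∣ P ∣ + ∣ Q ∣
length-vertices P Q = trans (length-++ (map inj₁ (elements P)))
  (cong₂ _+_ (trans (length-map inj₁ (elements P)) (length-elements P))
             (trans (length-map inj₂ (elements Q)) (length-elements Q)))

InPair : ∀ {p q} → Subset p → Subset q → Fin p ⊎ Fin q → Set
InPair P Q (inj₁ a) = a ∈ₛ P
InPair P Q (inj₂ b) = b ∈ₛ Q

∈-vertices⁻ : ∀ {p q} (P : Subset p) (Q : Subset q) {x} → x ∈ vertices P Q → InPair P Q x
∈-vertices⁻ P Q x∈ with ∈-++⁻ (map inj₁ (elements P)) x∈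
... | inj₁ x∈₁ with ∈-map⁻ inj₁ x∈₁
...   | a , a∈ , refl = ∈-elements⁻ P a∈
∈-vertices⁻ P Q x∈ | inj₂ x∈₂ with ∈-map⁻ inj₂ x∈₂
...   | b , b∈ , refl = ∈-elements⁻ Q b∈

vertices-unique : ∀ {p q} (P : Subset p) (Q : Subset q) → Unique (vertices P Q)
vertices-unique P Q = ++⁺ (map⁺ Sum.inj₁-injective (elements-unique P))
                          (map⁺ Sum.inj₂-injective (elements-unique Q)) inj₁≢inj₂
  where
  inj₁≢inj₂ : Disjoint (map inj₁ (elements P)) (map inj₂ (elements Q))
  inj₁≢inj₂ (x∈₁ , x∈₂) with ∈-map⁻ inj₁ x∈₁ | ∈-map⁻ inj₂ x∈₂
  ... | _ , _ , refl | _ , _ , ()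

module _ {p q} (G : Bipartite (Fin p) (Fin q)) where
  open Traces (Sum.≡-dec (Fin._≟_ {p}) (Fin._≟_ {q}))

  Independent⇒vertices-stable : ∀ {P Q} → Independent G P Q → IsStable (adjB G) (vertices P Q)
  Independent⇒vertices-stable {P} {Q} ind =
    vertices-unique P Q , λ x y x∈ y∈ → no-edge x y (∈-vertices⁻ P Q x∈) (∈-vertices⁻ P Q y∈)
    where
    no-edge : ∀ x y → InPair P Q x → InPair P Q y → ¬ adjB G x y
    no-edge (inj₁ a) (inj₂ b) a∈ b∈ = ind a b a∈ b∈
    no-edge (inj₂ b) (inj₁ a) b∈ a∈ = ind a b a∈ b∈
    no-edge (inj₁ _) (inj₁ _) _  _  = λ ()
    no-edge (inj₂ _) (inj₂ _) _  _  = λ ()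

  stable⇒trace-independent : ∀ {S} → IsStable (adjB G) S → Independent G (trace inj₁ S) (trace inj₂ S)
  stable⇒trace-independent (_ , no-edge) a b a∈ b∈ =
    no-edge (inj₁ a) (inj₂ b) (∈-trace⁻ a∈) (∈-trace⁻ b∈)

  length≤∣trace∣+∣trace∣ : ∀ {S} → Unique S → length S ≤ ∣ trace inj₁ S ∣ + ∣ trace inj₂ S ∣
  length≤∣trace∣+∣trace∣ {S} S! = subst (length S ≤_) (sym (cong₂ _+_ (∣trace∣ inj₁ S) (∣trace∣ inj₂ S)))
    (length≤∑𝟙[∈] (Fin-summation p ⊎-summation Fin-summation q) S!)

  IsIndependenceNumber⇒IsAlpha : ∀ {k} → IsIndependenceNumber G k → IsAlpha (adjB G) k
  IsIndependenceNumber⇒IsAlpha (((P , Q) , ind , k≤) , bound) =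
    (vertices P Q , Independent⇒vertices-stable ind ,
     trans (length-vertices P Q) (≤-antisym (bound P Q ind) k≤)) ,
    λ S stable → ≤-trans (length≤∣trace∣+∣trace∣ (proj₁ stable))
                         (bound _ _ (stable⇒trace-independent stable))

  IsAlpha⇒IndependenceBound : ∀ {adj k} → adj ⇒ adjB G → IsAlpha adj k → IndependenceBound G k
  IsAlpha⇒IndependenceBound {k = k} adj⇒G (_ , bound) P Q ind = subst (_≤ k) (length-vertices P Q)
    (bound (vertices P Q) (IsStable-antitone adj⇒G (Independent⇒vertices-stable ind)))

Maximum-ᵀ : ∀ {p q} {G : Bipartite (Fin p) (Fin q)} {k P Q} → Maximum G k (P , Q) → Maximum (G ᵀ) k (Q , P)
Maximum-ᵀ {k = k} {P} {Q} (ind , k≤) = Independent-ᵀ ind , subst (k ≤_) (+-comm ∣ P ∣ ∣ Q ∣) k≤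

IndependenceBound-ᵀ : ∀ {p q} {G : Bipartite (Fin p) (Fin q)} {k} →
                      IndependenceBound G k → IndependenceBound (G ᵀ) k
IndependenceBound-ᵀ {k = k} bound Q P ind = subst (_≤ k) (+-comm ∣ P ∣ ∣ Q ∣) (bound P Q (Independent-ᵀ ind))

∩∪-independent : ∀ {p q} {G : Bipartite (Fin p) (Fin q)} {P₁ Q₁ P Q} →
                 Independent G P₁ Q₁ → Independent G P Q → Independent G (P₁ ∩ P) (Q₁ ∪ Q)
∩∪-independent {P₁ = P₁} {Q₁} {P} {Q} ind₁ ind a b a∈ b∈ with x∈p∪q⁻ Q₁ Q b∈
... | inj₁ b∈Q₁ = ind₁ a b (proj₁ (x∈p∩q⁻ P₁ P a∈)) b∈Q₁
... | inj₂ b∈Q  = ind  a b (proj₂ (x∈p∩q⁻ P₁ P a∈)) b∈Q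

∪∩-independent : ∀ {p q} {G : Bipartite (Fin p) (Fin q)} {P₁ Q₁ P Q} →
                 Independent G P₁ Q₁ → Independent G P Q → Independent G (P₁ ∪ P) (Q₁ ∩ Q)
∪∩-independent ind₁ ind = Independent-ᵀ (∩∪-independent (Independent-ᵀ ind₁) (Independent-ᵀ ind))

infix 4 _⊆ᴮ_

_⊆ᴮ_ : ∀ {X Y} → Bipartite X Y → Bipartite X Y → Set
G ⊆ᴮ G′ = ∀ {x y} → T (E G x y) → T (E G′ x y)

_∖_ : ∀ {X Y} {{_ : IsDecEquivalence {A = X × Y} _≡_}} → Bipartite X Y → X × Y → Bipartite X Y
G ∖ e = bip λ x y → E G x y ∧ does (¬? ((x , y) ≟ e))

module _ {X Y} {{X×Y-dec : IsDecEquivalence {A = X × Y} _≡_}} {G : Bipartite X Y} where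
  open IsDecEquivalence X×Y-dec using () renaming (_≟_ to _≟ₑ_)

  ∖-edge⁻ : ∀ {e : X × Y} {x : X} {y : Y} → T (E (G ∖ e) x y) → T (E G x y) × (x , y) ≢ e
  ∖-edge⁻ {e} {x} {y} t = proj₁ (to T-∧ t) , does⇒ (¬? ((x , y) ≟ₑ e)) (proj₂ (to T-∧ t))

  ∖-edge⁺ : ∀ {e : X × Y} {x : X} {y : Y} → T (E G x y) → (x , y) ≢ e → T (E (G ∖ e) x y)
  ∖-edge⁺ {e} {x} {y} t ≢e = from T-∧ (t , ⇒does (¬? ((x , y) ≟ₑ e)) ≢e)

  deleteEdge⇒∖ : ∀ {x₀ : X} {y₀ : Y} → deleteEdge (adjB G) (inj₁ x₀) (inj₂ y₀) ⇒ adjB (G ∖ (x₀ , y₀))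
  deleteEdge⇒∖ {x = inj₁ x} {inj₂ y} (e , ≢x₀y₀) = ∖-edge⁺ e λ { refl → ≢x₀y₀ (inj₁ (refl , refl)) }
  deleteEdge⇒∖ {x = inj₂ y} {inj₁ x} (e , ≢x₀y₀) = ∖-edge⁺ e λ { refl → ≢x₀y₀ (inj₂ (refl , refl)) }

  ∖⇒deleteEdge : ∀ {x₀ : X} {y₀ : Y} → adjB (G ∖ (x₀ , y₀)) ⇒ deleteEdge (adjB G) (inj₁ x₀) (inj₂ y₀)
  ∖⇒deleteEdge {x = inj₁ x} {inj₂ y} e with ∖-edge⁻ e
  ... | e′ , ≢x₀y₀ = e′ , λ { (inj₁ (refl , refl)) → ≢x₀y₀ refl ; (inj₂ (() , _)) }
  ∖⇒deleteEdge {x = inj₂ y} {inj₁ x} e with ∖-edge⁻ e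
  ... | e′ , ≢x₀y₀ = e′ , λ { (inj₁ (() , _)) ; (inj₂ (refl , refl)) → ≢x₀y₀ refl }

∖⊗⊆⊗∖ : ∀ {X Y Z W} {{_ : IsDecEquivalence {A = X × Y} _≡_}}
          {{_ : IsDecEquivalence {A = (X × Z) × (Y × W)} _≡_}} {G : Bipartite X Y} {H : Bipartite Z W} {a₀ b₀ c₀ d₀} →
        (G ∖ (a₀ , b₀)) ⊗ H ⊆ᴮ (G ⊗ H) ∖ ((a₀ , c₀) , (b₀ , d₀))
∖⊗⊆⊗∖ {G = G} {H} {x = a , c} {b , d} e with to T-∧ e
... | eG∖ , eH with ∖-edge⁻ {G = G} eG∖
...   | eG , ≢a₀b₀ = ∖-edge⁺ {G = G ⊗ H} (from T-∧ (eG , eH)) λ { refl → ≢a₀b₀ refl }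

-- α⁺-stable balanced bipartite graphs

module _ {p q} (G : Bipartite (Fin p) (Fin q)) {k} (bound : IndependenceBound G k) where

  ∩∪-maximum : ∀ {P₁ Q₁ P Q} → Maximum G k (P₁ , Q₁) → Maximum G k (P , Q) →
               Maximum G k (P₁ ∩ P , Q₁ ∪ Q)
  ∩∪-maximum {P₁} {Q₁} {P} {Q} (ind₁ , k≤₁) (ind , k≤) =
    ∩∪-independent ind₁ ind , +-cancelʳ-≤ k k (∣ P₁ ∩ P ∣ + ∣ Q₁ ∪ Q ∣) (begin
      k + k
        ≤⟨ +-mono-≤ k≤₁ k≤ ⟩
      (∣ P₁ ∣ + ∣ Q₁ ∣) + (∣ P ∣ + ∣ Q ∣)
        ≡⟨ ∩∪-∪∩-size P₁ P Q₁ Q ⟨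
      (∣ P₁ ∩ P ∣ + ∣ Q₁ ∪ Q ∣) + (∣ P₁ ∪ P ∣ + ∣ Q₁ ∩ Q ∣)
        ≤⟨ +-monoʳ-≤ _ (bound _ _ (∪∩-independent ind₁ ind)) ⟩
      (∣ P₁ ∩ P ∣ + ∣ Q₁ ∪ Q ∣) + k
        ∎)
    where
    open ≤-Reasoning

  Q-largest⇒P⊆core : ∀ {P₁ Q₁} → Maximum G k (P₁ , Q₁) →
                     (∀ {P Q} → Maximum G k (P , Q) → ∣ Q ∣ ≤ ∣ Q₁ ∣) →
                     ∀ {u} → u ∈ₛ P₁ → ∀ {P Q} → Maximum G k (P , Q) → u ∈ₛ P
  Q-largest⇒P⊆core {P₁} {Q₁} max₁ largest {u} u∈P₁ {P} {Q} max with u ∈ₛ? P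
  ... | yes u∈P = u∈P
  ... | no  u∉P = ⊥-elim (<⇒≱ meet-smaller (proj₂ meet-maximum))
    where
    meet-maximum = ∩∪-maximum max₁ max
    P₁∩P⊂P₁ : P₁ ∩ P ⊂ P₁
    P₁∩P⊂P₁ = p∩q⊆p P₁ P , u , u∈P₁ , u∉P ∘ proj₂ ∘ x∈p∩q⁻ P₁ P
    meet-smaller : ∣ P₁ ∩ P ∣ + ∣ Q₁ ∪ Q ∣ < k
    meet-smaller = <-≤-trans (+-mono-<-≤ (p⊂q⇒∣p∣<∣q∣ P₁∩P⊂P₁) (largest meet-maximum))
                             (bound P₁ Q₁ (proj₁ max₁))

  core-nonempty : q < k → ∃ (Maximum G k) → ∃ λ u → ∀ {P Q} → Maximum G k (P , Q) → u ∈ₛ P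
  core-nonempty q<k ∃max with argmax searchable-Subset²
                                 (λ (P , Q) → independent? G P Q ×-dec (k ≤? ∣ P ∣ + ∣ Q ∣))
                                 (∣_∣ ∘ proj₂) {q} (λ (_ , Q) _ → ∣p∣≤n Q) ∃max
  ... | (P₁ , Q₁) , max₁ , largest with nonempty? P₁
  ...   | yes (u , u∈P₁) = u , Q-largest⇒P⊆core max₁ (λ {P} {Q} → largest (P , Q)) u∈P₁
  ...   | no  P₁-empty   = ⊥-elim (<⇒≱ q<k (begin
          k                 ≤⟨ proj₂ max₁ ⟩
          ∣ P₁ ∣ + ∣ Q₁ ∣    ≡⟨ cong (λ P → ∣ P ∣ + ∣ Q₁ ∣) (Empty-unique P₁-empty) ⟩
          ∣ ∅ {p} ∣ + ∣ Q₁ ∣ ≡⟨ cong (_+ ∣ Q₁ ∣) (∣⊥∣≡0 p) ⟩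
          ∣ Q₁ ∣             ≤⟨ ∣p∣≤n Q₁ ⟩
          q                 ∎))
    where open ≤-Reasoning

module _ {n} (G : Balanced n) (α⁺ : AlphaPlusStable (adjB G)) where
  open Traces (Sum.≡-dec (Fin._≟_ {n}) (Fin._≟_ {n}))

  α⁺-stable⇒¬core-pair : ∀ {k} → IsIndependenceNumber G k → ∀ {u v} →
                         ¬ (∀ {P Q} → Maximum G k (P , Q) → u ∈ₛ P × v ∈ₛ Q)
  α⁺-stable⇒¬core-pair {k} number@((_ , max₀) , _) {u} {v} in-core =
    let (S , stable⁺ , |S|≡k) , _ = α⁺ (inj₁ u) (inj₂ v) (λ ()) u≁v k (IsIndependenceNumber⇒IsAlpha G number)
    in no-stable-set-of-size-k stable⁺ |S|≡k
    where
    u≁v : ¬ T (E G u v)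
    u≁v = proj₁ max₀ u v (proj₁ (in-core max₀)) (proj₂ (in-core max₀))
    no-stable-set-of-size-k : ∀ {S} → IsStable (addEdge (adjB G) (inj₁ u) (inj₂ v)) S → length S ≡ k → ⊥
    no-stable-set-of-size-k {S} stable⁺@(S! , no-edge) |S|≡k =
      no-edge (inj₁ u) (inj₂ v) (∈-trace⁻ (proj₁ (in-core traces-maximum)))
              (∈-trace⁻ (proj₂ (in-core traces-maximum))) (inj₂ (inj₁ (refl , refl)))
      where
      traces-maximum : Maximum G k (trace inj₁ S , trace inj₂ S)
      traces-maximum = stable⇒trace-independent G (IsStable-antitone inj₁ stable⁺) ,
                       subst (_≤ ∣ trace inj₁ S ∣ + ∣ trace inj₂ S ∣) |S|≡k (length≤∣trace∣+∣trace∣ G S!)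

  α⁺-stable⇒IndependenceBound : IndependenceBound G n
  α⁺-stable⇒IndependenceBound with independence-number G
  ... | k , number@(max₀ , bound) = λ P Q ind → ≤-trans (bound P Q ind) k≤n
    where
    k≤n : k ≤ n
    k≤n = ≮⇒≥ λ n<k →
      let u , u-core = core-nonempty G bound n<k max₀
          v , v-core = core-nonempty (G ᵀ) (IndependenceBound-ᵀ bound) n<k (_ , Maximum-ᵀ (proj₂ max₀))
      in α⁺-stable⇒¬core-pair number λ max → u-core max , v-core (Maximum-ᵀ max)

-- Kronecker products

fractional-bound : ∀ {r s M N} (H : Bipartite (Fin r) (Fin s)) → IndependenceBound H M →
                   (x : Fin r → ℕ) (y : Fin s → ℕ) → (∀ c → x c ≤ N) → (∀ d → y d ≤ N) →
                   (∀ c d → T (E H c d) → x c + y d ≤ N) →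
                   ∑[ c < r ] x c + ∑[ d < s ] y d ≤ N * M
fractional-bound {r} {s} {M} {N} H bound x y x≤N y≤N edge≤N = begin
  ∑[ c < r ] x c + ∑[ d < s ] y d
    ≡⟨ cong₂ _+_ (sum-cong-≗ λ c → ∑-< N (x≤N c))
                 (sum-cong-≗ λ d → trans (∑-≮ N (N ∸ y d)) (m∸[m∸n]≡n (y≤N d))) ⟨
  ∑[ c < r ] ∑[ t < N ] 𝟙 (lower t c) + ∑[ d < s ] ∑[ t < N ] 𝟙 (upper t d)
    ≡⟨ cong₂ _+_ (∑-comm λ c t → 𝟙 (lower t c)) (∑-comm λ d t → 𝟙 (upper t d)) ⟩
  ∑[ t < N ] ∑[ c < r ] 𝟙 (lower t c) + ∑[ t < N ] ∑[ d < s ] 𝟙 (upper t d)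
    ≡⟨ ∑-distrib-+ (λ t → ∑[ c < r ] 𝟙 (lower t c)) (λ t → ∑[ d < s ] 𝟙 (upper t d)) ⟨
  ∑[ t < N ] (∑[ c < r ] 𝟙 (lower t c) + ∑[ d < s ] 𝟙 (upper t d))
    ≡⟨ sum-cong-≗ (λ t → cong₂ _+_ (∣tabulate∣ (lower t)) (∣tabulate∣ (upper t))) ⟨
  ∑[ t < N ] (∣ tabulate (lower t) ∣ + ∣ tabulate (upper t) ∣)
    ≤⟨ ∑-mono-≤ (λ t → bound _ _ (layers-independent t)) ⟩
  ∑[ t < N ] M
    ≡⟨ ∑-const N M ⟩
  N * M
    ∎
  where
  open ≤-Reasoning
  lower : Fin N → Fin r → Bool
  lower t c = does (toℕ t <? x c)
  upper : Fin N → Fin s → Bool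
  upper t d = does (¬? (toℕ t <? N ∸ y d))
  layers-independent : ∀ t → Independent H (tabulate (lower t)) (tabulate (upper t))
  layers-independent t c d c∈ d∈ e = <-irrefl refl (begin-strict
    N              ≡⟨ m∸n+n≡m (y≤N d) ⟨
    N ∸ y d + y d  <⟨ +-monoˡ-< (y d) (≤-<-trans (≮⇒≥ (does⇒ (¬? (toℕ t <? N ∸ y d)) (∈-tabulate⁻ d∈)))
                                                 (does⇒ (toℕ t <? x c) (∈-tabulate⁻ c∈))) ⟩
    x c + y d      ≤⟨ edge≤N c d e ⟩
    N              ∎)

module _ {p q r s N M} {G : Bipartite (Fin p) (Fin q)} {H : Bipartite (Fin r) (Fin s)}
         {K : Bipartite (Fin p × Fin r) (Fin q × Fin s)}
         (G-bound : IndependenceBound G N) (H-bound : IndependenceBound H M) (G⊗H⊆K : G ⊗ H ⊆ᴮ K) where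
  open Traces (Sum.≡-dec (Prod.≡-dec (Fin._≟_ {p}) (Fin._≟_ {r})) (Prod.≡-dec (Fin._≟_ {q}) (Fin._≟_ {s})))

  ⊗-stable-bound : ∀ {S} → IsStable (adjB K) S → length S ≤ N * M
  ⊗-stable-bound {S} (S! , no-edge) = begin
    length S
      ≤⟨ length≤∑𝟙[∈] ((Fin-summation p ×-summation Fin-summation r) ⊎-summation
                       (Fin-summation q ×-summation Fin-summation s)) S! ⟩
    ∑[ a < p ] ∑[ c < r ] 𝟙[ inj₁ (a , c) ] + ∑[ b < q ] ∑[ d < s ] 𝟙[ inj₂ (b , d) ]
      ≡⟨ cong₂ _+_ (∑-comm λ a c → 𝟙[ inj₁ (a , c) ]) (∑-comm λ b d → 𝟙[ inj₂ (b , d) ]) ⟩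
    ∑[ c < r ] ∑[ a < p ] 𝟙[ inj₁ (a , c) ] + ∑[ d < s ] ∑[ b < q ] 𝟙[ inj₂ (b , d) ]
      ≡⟨ cong₂ _+_ (sum-cong-≗ λ c → ∣trace∣ (λ a → inj₁ (a , c)) S)
                   (sum-cong-≗ λ d → ∣trace∣ (λ b → inj₂ (b , d)) S) ⟨
    ∑[ c < r ] ∣ row c ∣ + ∑[ d < s ] ∣ column d ∣
      ≤⟨ fractional-bound H H-bound (∣_∣ ∘ row) (∣_∣ ∘ column)
           (IndependenceBound⇒∣P∣≤ G-bound ∘ row) (IndependenceBound⇒∣Q∣≤ G-bound ∘ column)
           (λ c d e → G-bound _ _ (row-column-independent e)) ⟩
    N * M
      ∎
    where
    open ≤-Reasoning
    𝟙[_] : (Fin p × Fin r) ⊎ (Fin q × Fin s) → ℕ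
    𝟙[ v ] = 𝟙 (does (v ∈? S))
    row : Fin r → Subset p
    row c = trace (λ a → inj₁ (a , c)) S
    column : Fin s → Subset q
    column d = trace (λ b → inj₂ (b , d)) S
    row-column-independent : ∀ {c d} → T (E H c d) → Independent G (row c) (column d)
    row-column-independent eH a b a∈ b∈ eG =
      no-edge _ _ (∈-trace⁻ a∈) (∈-trace⁻ b∈) (G⊗H⊆K (from T-∧ (eG , eH)))

length-cartesianProduct : ∀ {A B : Set} (xs : List A) (ys : List B) →
                          length (cartesianProduct xs ys) ≡ length xs * length ys
length-cartesianProduct []       ys = refl
length-cartesianProduct (x ∷ xs) ys = trans (length-++ (map (x ,_) ys))
  (cong₂ _+_ (length-map (x ,_) ys) (length-cartesianProduct xs ys))

module Kronecker {n m} (G : Balanced n) (H : Balanced m) (α⁻G : AlphaMinusStable (adjB G))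
                 (α⁺G : AlphaPlusStable (adjB G)) (α⁺H : AlphaPlusStable (adjB H)) where
  open import Data.Fin.Instances
  open import Data.Product.Instances

  K : Bipartite (Fin n × Fin m) (Fin n × Fin m)
  K = G ⊗ H

  G-bound : IndependenceBound G n
  G-bound = α⁺-stable⇒IndependenceBound G α⁺G

  H-bound : IndependenceBound H m
  H-bound = α⁺-stable⇒IndependenceBound H α⁺H

  α[G]≡n : IsAlpha (adjB G) n
  α[G]≡n = IsIndependenceNumber⇒IsAlpha G (((⊤ , ∅) , (λ _ _ _ b∈∅ → ⊥-elim (∉⊥ b∈∅)) , n≤∣⊤∣+∣∅∣) , G-bound)
    where
    n≤∣⊤∣+∣∅∣ : n ≤ ∣ ⊤ {n} ∣ + ∣ ∅ {n} ∣
    n≤∣⊤∣+∣∅∣ = ≤-reflexive (sym (trans (cong₂ _+_ (∣⊤∣≡n n) (∣⊥∣≡0 n)) (+-identityʳ n)))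

  G∖e-bound : ∀ {a b} → T (E G a b) → IndependenceBound (G ∖ (a , b)) n
  G∖e-bound {a} {b} e = IsAlpha⇒IndependenceBound (G ∖ (a , b)) deleteEdge⇒∖ (α⁻G (inj₁ a) (inj₂ b) e n α[G]≡n)

  K-bound : ∀ {S} → IsStable (adjB K) S → length S ≤ n * m
  K-bound = ⊗-stable-bound G-bound H-bound id

  K∖e-bound : ∀ {u v} → adjB K u v → ∀ {S} → IsStable (deleteEdge (adjB K) u v) S → length S ≤ n * m
  K∖e-bound {inj₁ (a , c)} {inj₂ (b , d)} e =
    ⊗-stable-bound (G∖e-bound (proj₁ (to T-∧ e))) H-bound
                   (∖⊗⊆⊗∖ {G = G} {H} {a} {b} {c} {d})
    ∘ IsStable-antitone (∖⇒deleteEdge {G = K})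
  K∖e-bound {inj₂ (b , d)} {inj₁ (a , c)} e =
    K∖e-bound {inj₁ (a , c)} {inj₂ (b , d)} e ∘ IsStable-antitone (deleteEdge-sym {adj = adjB K})

  allPairs : List (Fin n × Fin m)
  allPairs = cartesianProduct (allFin n) (allFin m)

  allPairs-unique : Unique allPairs
  allPairs-unique = cartesianProduct⁺ (allFin⁺ n) (allFin⁺ m)

  length-allPairs : length allPairs ≡ n * m
  length-allPairs = trans (length-cartesianProduct (allFin n) (allFin m))
                          (cong₂ _*_ (length-tabulate {n = n} id) (length-tabulate {n = m} id))

  length-side : ∀ {V : Set} (ι : Fin n × Fin m → V) → length (map ι allPairs) ≡ n * m
  length-side ι = trans (length-map ι allPairs) length-allPairs

  α[K]≡nm : ∀ {k} → IsAlpha (adjB K) k → k ≡ n * m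
  α[K]≡nm ((S , stable , refl) , bound) = ≤-antisym (K-bound stable)
    (subst (_≤ length S) (length-side inj₁)
           (bound _ (map-stable Sum.inj₁-injective (λ _ _ ()) allPairs-unique)))

  side₁-stable : ∀ {y v} → IsStable (addEdge (adjB K) (inj₂ y) v) (map inj₁ allPairs)
  side₁-stable = map-stable Sum.inj₁-injective
    (λ { _ _ (inj₁ ()) ; _ _ (inj₂ (inj₁ (() , _))) ; _ _ (inj₂ (inj₂ (_ , ()))) }) allPairs-unique

  side₂-stable : ∀ {x v} → IsStable (addEdge (adjB K) (inj₁ x) v) (map inj₂ allPairs)
  side₂-stable = map-stable Sum.inj₂-injective
    (λ { _ _ (inj₁ ()) ; _ _ (inj₂ (inj₁ (() , _))) ; _ _ (inj₂ (inj₂ (_ , ()))) }) allPairs-unique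

corollary12 : (n m : ℕ) (G : Balanced n) (H : Balanced m)
    → AlphaStable (adjB G) → AlphaStable (adjB H)
    → AlphaStable (adjB (G ⊗ H))
corollary12 n m G H (α⁻G , α⁺G) (_ , α⁺H) = α⁻K , α⁺K
  where
  open Kronecker G H α⁻G α⁺G α⁺H

  α⁻K : AlphaMinusStable (adjB K)
  α⁻K u v e k α = IsAlpha-deleteEdge α λ S stable →
    subst (length S ≤_) (sym (α[K]≡nm α)) (K∖e-bound e stable)

  α⁺K : AlphaPlusStable (adjB K)
  α⁺K (inj₁ x) v _ _ k α =
    IsAlpha-addEdge α (map inj₂ allPairs , side₂-stable , trans (length-side inj₂) (sym (α[K]≡nm α)))
  α⁺K (inj₂ y) v _ _ k α =
    IsAlpha-addEdge α (map inj₁ allPairs , side₁-stable , trans (length-side inj₁) (sym (α[K]≡nm α)))
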